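{- The sparing number of the dodecahedron graph is $6$.
   Context: For $A,B\subseteq\mathbb{N}_0$, $A+B=\{a+b: a\in A, b\in B\}$. An integer additive set-indexer (IASI) of a graph $G$ is an injective $f:V(G)\to 2^{\mathbb{N}_0}$ such that $g_f(uv)=f(u)+f(v)$ is injective on $E(G)$. It is a weak IASI if $|g_f(uv)|=\max(|f(u)|,|f(v)|)$ for every edge $uv$. An edge is mono-indexed if its set-label has cardinality $1$. The sparing number $\varphi(G)$ is the minimum, over all weak IASIs of $G$, of the number of mono-indexed edges. The dodecahedron graph is the $1$-skeleton of the regular dodecahedron: a $3$-regular planar graph with $20$ vertices, $30$ edges and $12$ pentagonal faces. -}

module Defs where

open import Data.Nat using (ℕ; _+_; _≟_; _≤_)
open import Data.Fin using (Fin; fromℕ<; _≟_)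
open import Data.List using (List; []; _∷_; map; concatMap; length; deduplicate; filter; allFin)
open import Data.List.Membership.Propositional using (_∈_)
open import Data.Product using (_×_; _,_; proj₁; proj₂; ∃-syntax)
open import Data.Vec using (Vec; lookup)
open import Relation.Binary.PropositionalEquality using (_≡_)
open import Relation.Nullary using (¬_)
open import Function.Bundles using (_⇔_)

-- Finite subsets of ℕ₀, presented by a list of their elements
-- (duplicates and order irrelevant; sets are compared extensionally).

SetEq : List ℕ → List ℕ → Set
SetEq A B = ∀ x → (x ∈ A) ⇔ (x ∈ B)

card : List ℕ → ℕ
card A = length (deduplicate Data.Nat._≟_ A)

_⊕_ : List ℕ → List ℕ → List ℕ
A ⊕ B = concatMap (λ a → map (a +_) B) A

record Graph : Set where
  field
    nV    : ℕ
    nE    : ℕ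
    ends  : Fin nE → Fin nV × Fin nV

open Graph public

max : ℕ → ℕ → ℕ
max = Data.Nat._⊔_

edgeLabel : (G : Graph) → (Fin (nV G) → List ℕ) → Fin (nE G) → List ℕ
edgeLabel G f e = f (proj₁ (ends G e)) ⊕ f (proj₂ (ends G e))

IsIASI : (G : Graph) → (Fin (nV G) → List ℕ) → Set
IsIASI G f =
  (∀ u v → SetEq (f u) (f v) → u ≡ v) ×
  (∀ e e' → SetEq (edgeLabel G f e) (edgeLabel G f e') → e ≡ e')

IsWeakIASI : (G : Graph) → (Fin (nV G) → List ℕ) → Set
IsWeakIASI G f = IsIASI G f ×
  (∀ e → card (edgeLabel G f e) ≡
           max (card (f (proj₁ (ends G e)))) (card (f (proj₂ (ends G e)))))

monoCount : (G : Graph) → (Fin (nV G) → List ℕ) → ℕ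
monoCount G f = length (filter (λ e → card (edgeLabel G f e) Data.Nat.≟ 1) (allFin (nE G)))

SparingNumberIs : Graph → ℕ → Set
SparingNumberIs G k =
  (∃[ f ] (IsWeakIASI G f × monoCount G f ≡ k)) ×
  (∀ f → IsWeakIASI G f → k ≤ monoCount G f)

-- Dodecahedron = generalized Petersen graph GP(10,2).
-- Outer vertices u_i = i, inner vertices v_i = 10 + i (i = 0..9).
-- Edges: u_i u_{i+1}, u_i v_i, v_i v_{i+2} (indices mod 10).

open import Data.Vec using ([]; _∷_)
open import Data.Fin using (#_)

dodecEdges : Vec (Fin 20 × Fin 20) 30
dodecEdges =
  (# 0 , # 1) ∷
  (# 1 , # 2) ∷
  (# 2 , # 3) ∷
  (# 3 , # 4) ∷
  (# 4 , # 5) ∷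
  (# 5 , # 6) ∷
  (# 6 , # 7) ∷
  (# 7 , # 8) ∷
  (# 8 , # 9) ∷
  (# 9 , # 0) ∷
  (# 0 , # 10) ∷
  (# 1 , # 11) ∷
  (# 2 , # 12) ∷
  (# 3 , # 13) ∷
  (# 4 , # 14) ∷
  (# 5 , # 15) ∷
  (# 6 , # 16) ∷
  (# 7 , # 17) ∷
  (# 8 , # 18) ∷
  (# 9 , # 19) ∷
  (# 10 , # 12) ∷
  (# 11 , # 13) ∷
  (# 12 , # 14) ∷
  (# 13 , # 15) ∷
  (# 14 , # 16) ∷
  (# 15 , # 17) ∷
  (# 16 , # 18) ∷
  (# 17 , # 19) ∷
  (# 18 , # 10) ∷
  (# 19 , # 11) ∷ []

dodecahedron : Graph
dodecahedron = record { nV = 20 ; nE = 30 ; ends = lookup dodecEdges }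

-- If the end labels A, B of an edge both have at least two elements, say b₁ < b₂ in B, then A + B contains
-- A + b₁ together with max A + b₂, so |A + B| > |A|; symmetrically |A + B| > |B|, contradicting
-- weakness. Hence in a weak IASI the singleton-labelled vertices form a vertex cover. A pentagon is
-- an odd cycle, so each of the 12 faces of the dodecahedron has an edge with both ends
-- singleton-labelled, which is mono-indexed; as every edge lies on exactly two faces, there are at
-- least 6 such edges. An explicit weak IASI attains 6.

module Submission where

open import Defs
open import Data.Bool using (Bool; true; false; T; not; _∧_; _∨_)
open import Data.Bool.Properties using (∧-comm; ∨-comm; T-∧; T-∨)
open import Data.Empty using (⊥; ⊥-elim)
open import Data.Fin using (Fin; #_)
import Data.Fin as Fin
open import Data.Fin.Patterns using (0F; 1F; 2F; 3F; 4F)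
open import Data.Fin.Properties using (any?; all?)
open import Data.List
  using (List; []; _∷_; _++_; length; map; filter; concatMap; tabulate; allFin; deduplicate; cartesianProductWith)
open import Data.List.Extrema.Nat using (argmax-sel; ⊥≤max; xs≤max) renaming (max to maxˡ)
open import Data.List.Membership.Propositional using (_∈_)
open import Data.List.Membership.Propositional.Properties
  using (∈-∃++; ∈-++⁻; ∈-++⁺ˡ; ∈-++⁺ʳ; ∈-map⁻; ∈-deduplicate⁻; ∈-deduplicate⁺; ∈-cartesianProductWith⁺)
open import Data.List.Properties using (length-++; length-map; filter-++; filter-some; cartesianProductWith-zeroʳ)
open import Data.List.Relation.Binary.Permutation.Propositional using (_↭_; ↭-refl; ↭-prep; ↭-sym; ↭-trans)
open import Data.List.Relation.Binary.Permutation.Propositional.Properties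
  using (↭-length; filter-↭; ∈-resp-↭; shift; drop-∷)
import Data.List.Relation.Binary.Sublist.Propositional as Sublist
import Data.List.Relation.Binary.Sublist.Propositional.Properties as Sublist
open import Data.List.Relation.Unary.All as All using (All; []; _∷_)
open import Data.List.Relation.Unary.AllPairs using ([]; _∷_)
open import Data.List.Relation.Unary.Any using (Any; here; there)
open import Data.List.Relation.Unary.Any.Properties using (tabulate⁺)
open import Data.List.Relation.Unary.Unique.Propositional using (Unique)
import Data.List.Relation.Unary.Unique.Propositional.Properties as Unique
open import Data.Nat using (ℕ; suc; _+_; _*_; _≤_; _<_; z≤n; s≤s; _⊔_; _≡ᵇ_)
import Data.Nat as ℕ
open import Data.Nat.Properties
  using ( +-comm; +-suc; +-identityʳ; +-cancelˡ-≡; +-mono-≤; +-mono-<-≤; *-monoʳ-≤; *-cancelˡ-≤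
        ; ≤-trans; <-irrefl; <-cmp; <⇒≢; ⊔-lub; ⊔-identityʳ; ≡ᵇ⇒≡; ≡⇒≡ᵇ; module ≤-Reasoning)
open import Data.List.Relation.Binary.Subset.Propositional using (_⊆_)
open import Data.List.Relation.Binary.Subset.DecPropositional ℕ._≟_ using (_⊆?_)
open import Data.List.Relation.Unary.Unique.DecPropositional.Properties ℕ._≟_ using (deduplicate-!)
open import Data.Product using (_×_; _,_; proj₁; proj₂; ∃; ∃₂)
open import Data.Product.Properties using (≡-dec)
open import Data.Sum using (_⊎_; inj₁; inj₂)
open import Data.Vec using (Vec; []; _∷_; lookup)
open import Function using (id; _∘_; case_of_)
open import Function.Bundles using (mk⇔; Equivalence)
open import Relation.Binary using (tri<; tri≈; tri>)
open import Relation.Binary.Definitions using (DecidableEquality)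
open import Relation.Binary.PropositionalEquality using (_≡_; _≢_; refl; sym; trans; cong; cong₂; subst)
open import Relation.Nullary using (¬_; Dec; yes; no)
open import Relation.Nullary.Decidable using (T?; toWitness; ¬?; _⊎-dec_)
open import Relation.Unary using (Pred; Decidable) renaming (_⊆_ to _⊆ᵖ_)

⊕≡cartesianProductWith : ∀ A B → A ⊕ B ≡ cartesianProductWith _+_ A B
⊕≡cartesianProductWith []      B = refl
⊕≡cartesianProductWith (a ∷ A) B = cong (map (a +_) B ++_) (⊕≡cartesianProductWith A B)

∈-⊕ : ∀ {a b A B} → a ∈ A → b ∈ B → a + b ∈ A ⊕ B
∈-⊕ {A = A} {B} a∈A b∈B =
  subst (_ ∈_) (sym (⊕≡cartesianProductWith A B)) (∈-cartesianProductWith⁺ _+_ a∈A b∈B)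

⊕-zeroʳ : ∀ A → A ⊕ [] ≡ []
⊕-zeroʳ A = trans (⊕≡cartesianProductWith A []) (cartesianProductWith-zeroʳ _+_ A)

card≡0⇒≡[] : ∀ {A} → card A ≡ 0 → A ≡ []
card≡0⇒≡[] {[]} _ = refl

Unique∧⊆⇒length≤ : ∀ {a} {A : Set a} {xs ys : List A} → Unique xs → xs ⊆ ys → length xs ≤ length ys
Unique∧⊆⇒length≤ [] _ = z≤n
Unique∧⊆⇒length≤ {xs = x ∷ xs} {ys} (x∉xs ∷ xs!) xs⊆ys with ∈-∃++ (xs⊆ys (here refl))
... | ys₁ , ys₂ , refl = begin
  suc (length xs)          ≤⟨ s≤s (Unique∧⊆⇒length≤ xs! xs⊆ys₁ys₂) ⟩
  suc (length (ys₁ ++ ys₂)) ≡⟨ cong suc (length-++ ys₁) ⟩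
  suc (length ys₁ + length ys₂) ≡⟨ +-suc (length ys₁) _ ⟨
  length ys₁ + suc (length ys₂) ≡⟨ length-++ ys₁ ⟨
  length (ys₁ ++ x ∷ ys₂)  ∎
  where
  open ≤-Reasoning
  xs⊆ys₁ys₂ : xs ⊆ ys₁ ++ ys₂
  xs⊆ys₁ys₂ {y} y∈xs with ∈-++⁻ ys₁ (xs⊆ys (there y∈xs))
  ... | inj₁ y∈ys₁         = ∈-++⁺ˡ y∈ys₁
  ... | inj₂ (here refl)   = ⊥-elim (All.lookup x∉xs y∈xs refl)
  ... | inj₂ (there y∈ys₂) = ∈-++⁺ʳ ys₁ y∈ys₂

Unique∧⊆⇒length≤card : ∀ {xs C} → Unique xs → xs ⊆ C → length xs ≤ card C
Unique∧⊆⇒length≤card xs! xs⊆C = Unique∧⊆⇒length≤ xs! (∈-deduplicate⁺ ℕ._≟_ ∘ xs⊆C)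

card≥2⇒two-elements : ∀ B → 2 ≤ card B → ∃₂ λ p q → p < q × p ∈ B × q ∈ B
card≥2⇒two-elements B 2≤|B|
  with deduplicate ℕ._≟_ B | deduplicate-! B | (λ {z} → ∈-deduplicate⁻ ℕ._≟_ B {z})
card≥2⇒two-elements B (s≤s ()) | _ ∷ [] | _ | _
card≥2⇒two-elements B _ | p ∷ q ∷ _ | (p≢q ∷ _) ∷ _ | ∈B with <-cmp p q
...   | tri< p<q _ _ = p , q , p<q , ∈B (here refl) , ∈B (there (here refl))
...   | tri≈ _ p≡q _ = ⊥-elim (p≢q p≡q)
...   | tri> _ _ q<p = q , p , q<p , ∈B (there (here refl)) , ∈B (here refl)

0<card⇒maximum : ∀ {Y} → 0 < card Y → ∃ λ m → m ∈ Y × All (_≤ m) Y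
0<card⇒maximum {y ∷ Ys} _ = maxˡ y Ys , max∈ (argmax-sel id y Ys) , ⊥≤max y Ys ∷ xs≤max y Ys
  where
  max∈ : maxˡ y Ys ≡ y ⊎ maxˡ y Ys ∈ Ys → maxˡ y Ys ∈ y ∷ Ys
  max∈ (inj₁ eq) = here eq
  max∈ (inj₂ m∈) = there m∈

-- x₂ + max Y is a point of C outside x₁ + Y.
card<card-of-two-translates : ∀ {x₁ x₂} Y C → x₁ < x₂ → 0 < card Y →
  (∀ {y} → y ∈ Y → x₁ + y ∈ C) → (∀ {y} → y ∈ Y → x₂ + y ∈ C) → card Y < card C
card<card-of-two-translates {x₁} {x₂} Y C x₁<x₂ 0<|Y| x₁+Y⊆C x₂+Y⊆C with 0<card⇒maximum 0<|Y|
... | m , m∈Y , Y≤m = begin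
  suc (card Y)                     ≡⟨ cong suc (length-map (x₁ +_) Ys) ⟨
  length (x₂ + m ∷ map (x₁ +_) Ys) ≤⟨ Unique∧⊆⇒length≤card (fresh ∷ x₁+Ys-unique) covered ⟩
  card C                           ∎
  where
  open ≤-Reasoning
  Ys : List ℕ
  Ys = deduplicate ℕ._≟_ Y
  x₁+Ys-unique : Unique (map (x₁ +_) Ys)
  x₁+Ys-unique = Unique.map⁺ (+-cancelˡ-≡ x₁ _ _) (deduplicate-! Y)
  fresh : All (x₂ + m ≢_) (map (x₁ +_) Ys)
  fresh = All.tabulate λ z∈ eq → case ∈-map⁻ (x₁ +_) z∈ of λ where
    (y , y∈ , refl) → <⇒≢ (+-mono-<-≤ x₁<x₂ (All.lookup Y≤m (∈-deduplicate⁻ ℕ._≟_ Y y∈))) (sym eq)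
  covered : x₂ + m ∷ map (x₁ +_) Ys ⊆ C
  covered (here refl) = x₂+Y⊆C m∈Y
  covered (there z∈) with ∈-map⁻ (x₁ +_) z∈
  ... | y , y∈ , refl = x₁+Y⊆C (∈-deduplicate⁻ ℕ._≟_ Y y∈)

card<card-⊕ˡ : ∀ {A B} → 0 < card A → 2 ≤ card B → card A < card (A ⊕ B)
card<card-⊕ˡ {A} {B} 0<|A| 2≤|B| with card≥2⇒two-elements B 2≤|B|
... | b₁ , b₂ , b₁<b₂ , b₁∈B , b₂∈B =
  card<card-of-two-translates A (A ⊕ B) b₁<b₂ 0<|A| (shifted b₁∈B) (shifted b₂∈B)
  where
  shifted : ∀ {b a} → b ∈ B → a ∈ A → b + a ∈ A ⊕ B
  shifted {b} {a} b∈B a∈A = subst (_∈ A ⊕ B) (+-comm a b) (∈-⊕ a∈A b∈B)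

card<card-⊕ʳ : ∀ {A B} → 2 ≤ card A → 0 < card B → card B < card (A ⊕ B)
card<card-⊕ʳ {A} {B} 2≤|A| 0<|B| with card≥2⇒two-elements A 2≤|A|
... | a₁ , a₂ , a₁<a₂ , a₁∈A , a₂∈A =
  card<card-of-two-translates B (A ⊕ B) a₁<a₂ 0<|B| (∈-⊕ a₁∈A) (∈-⊕ a₂∈A)

card⊔card<card-⊕ : ∀ {A B} → 2 ≤ card A → 2 ≤ card B → card A ⊔ card B < card (A ⊕ B)
card⊔card<card-⊕ {A} {B} 2≤|A| 2≤|B| =
  ⊔-lub (card<card-⊕ˡ {A} {B} (≤-trans (s≤s z≤n) 2≤|A|) 2≤|B|)
        (card<card-⊕ʳ {A} {B} 2≤|A| (≤-trans (s≤s z≤n) 2≤|B|))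

WeaklySummable : List ℕ → List ℕ → Set
WeaklySummable A B = card (A ⊕ B) ≡ card A ⊔ card B

weakly-summable-with-empty⇒both-empty : ∀ {A B} → WeaklySummable A B → card A ≡ 0 ⊎ card B ≡ 0 → A ≡ [] × B ≡ []
weakly-summable-with-empty⇒both-empty {A} {B} eq (inj₁ |A|≡0) with card≡0⇒≡[] {A} |A|≡0
... | refl = refl , card≡0⇒≡[] (sym eq)
weakly-summable-with-empty⇒both-empty {A} {B} eq (inj₂ |B|≡0) with card≡0⇒≡[] {B} |B|≡0
... | refl = card≡0⇒≡[] |A|≡0 , refl
  where
  |A|≡0 : card A ≡ 0
  |A|≡0 = trans (sym (⊔-identityʳ (card A))) (trans (sym eq) (cong card (⊕-zeroʳ A)))

both-empty⇒SetEq : ∀ {A B} → A ≡ [] × B ≡ [] → SetEq A B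
both-empty⇒SetEq (refl , refl) _ = mk⇔ id id

zero-one-or-more : ∀ n → n ≡ 0 ⊎ n ≡ 1 ⊎ 2 ≤ n
zero-one-or-more 0             = inj₁ refl
zero-one-or-more 1             = inj₂ (inj₁ refl)
zero-one-or-more (suc (suc n)) = inj₂ (inj₂ (s≤s (s≤s z≤n)))

weakly-summable⇒singleton : ∀ {A B} → WeaklySummable A B → ¬ SetEq A B → card A ≡ 1 ⊎ card B ≡ 1
weakly-summable⇒singleton {A} {B} eq A≉B with zero-one-or-more (card A) | zero-one-or-more (card B)
... | inj₂ (inj₁ |A|≡1) | _                  = inj₁ |A|≡1
... | _                 | inj₂ (inj₁ |B|≡1)  = inj₂ |B|≡1
... | inj₁ |A|≡0        | _                  = ⊥-elim (A≉B (both-empty⇒SetEq (weakly-summable-with-empty⇒both-empty {A} {B} eq (inj₁ |A|≡0))))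
... | inj₂ (inj₂ _)     | inj₁ |B|≡0         = ⊥-elim (A≉B (both-empty⇒SetEq (weakly-summable-with-empty⇒both-empty {A} {B} eq (inj₂ |B|≡0))))
... | inj₂ (inj₂ 2≤|A|) | inj₂ (inj₂ 2≤|B|)  = ⊥-elim (<-irrefl (sym eq) (card⊔card<card-⊕ {A} {B} 2≤|A| 2≤|B|))

count : ∀ {a p} {A : Set a} {P : Pred A p} → Decidable P → List A → ℕ
count P? xs = length (filter P? xs)

module _ {a p} {A : Set a} {P : Pred A p} (P? : Decidable P) where

  count-++ : ∀ xs ys → count P? (xs ++ ys) ≡ count P? xs + count P? ys
  count-++ xs ys = trans (cong length (filter-++ P? xs ys)) (length-++ (filter P? xs))

  count-↭ : ∀ {xs ys} → xs ↭ ys → count P? xs ≡ count P? ys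
  count-↭ xs↭ys = ↭-length (filter-↭ P? xs↭ys)

  count-mono : ∀ {q} {Q : Pred A q} (Q? : Decidable Q) → P ⊆ᵖ Q → ∀ xs → count P? xs ≤ count Q? xs
  count-mono Q? P⊆Q xs = Sublist.length-mono-≤ (Sublist.filter⁺ P? Q? (λ { refl → P⊆Q }) (Sublist.⊆-refl {x = xs}))

  length≤count-concatMap : ∀ {b} {B : Set b} {f : B → List A} →
    (∀ x → Any P (f x)) → ∀ xs → length xs ≤ count P? (concatMap f xs)
  length≤count-concatMap hit [] = z≤n
  length≤count-concatMap {f = f} hit (x ∷ xs) =
    subst (suc (length xs) ≤_) (sym (count-++ (f x) (concatMap f xs)))
      (+-mono-≤ (filter-some P? (hit x)) (length≤count-concatMap hit xs))

module _ {a} {A : Set a} (_≟_ : DecidableEquality A) where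

  open import Data.List.Membership.DecPropositional _≟_ using (_∈?_)

  infix 4 _↭?_
  _↭?_ : (xs ys : List A) → Dec (xs ↭ ys)
  []       ↭? []      = yes ↭-refl
  []       ↭? (_ ∷ _) = no λ p → case ↭-length p of λ ()
  (x ∷ xs) ↭? ys with x ∈? ys
  ... | no x∉ys = no λ p → x∉ys (∈-resp-↭ p (here refl))
  ... | yes x∈ys with ∈-∃++ x∈ys
  ...   | ys₁ , ys₂ , refl with xs ↭? ys₁ ++ ys₂
  ...     | yes p = yes (↭-trans (↭-prep x p) (↭-sym (shift x ys₁ ys₂)))
  ...     | no ¬p = no λ q → ¬p (drop-∷ (↭-trans q (shift x ys₁ ys₂)))

Joins : (G : Graph) → Fin (nE G) → Fin (nV G) → Fin (nV G) → Set
Joins G e x y = ends G e ≡ (x , y) ⊎ ends G e ≡ (y , x)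

Loopless : Graph → Set
Loopless G = ∀ e → proj₁ (ends G e) ≢ proj₂ (ends G e)

next : Fin 5 → Fin 5
next 0F = 1F
next 1F = 2F
next 2F = 3F
next 3F = 4F
next 4F = 0F

record Pentagon (G : Graph) : Set where
  field
    corner : Fin 5 → Fin (nV G)
    side   : Fin 5 → Fin (nE G)
    joins  : ∀ i → Joins G (side i) (corner i) (corner (next i))

  sides : List (Fin (nE G))
  sides = tabulate side

open Pentagon using (sides)

covered∧¬both⇒alternate : ∀ {x y} → T (x ∨ y) → ¬ T (x ∧ y) → y ≡ not x
covered∧¬both⇒alternate {false} {true}  _ _ = refl
covered∧¬both⇒alternate {true}  {false} _ _ = refl
covered∧¬both⇒alternate {true}  {true}  _ ¬both = ⊥-elim (¬both _)

alternating-pentagon-impossible : ∀ {a b c d e} →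
  b ≡ not a → c ≡ not b → d ≡ not c → e ≡ not d → a ≡ not e → ⊥
alternating-pentagon-impossible {false} refl refl refl refl ()
alternating-pentagon-impossible {true}  refl refl refl refl ()

-- An odd cycle has no proper 2-colouring, so a vertex cover of it contains two adjacent vertices.
pentagon-cover-has-adjacent-pair : (c : Fin 5 → Bool) →
  (∀ i → T (c i ∨ c (next i))) → ∃ λ i → T (c i ∧ c (next i))
pentagon-cover-has-adjacent-pair c covered with any? (λ i → T? (c i ∧ c (next i)))
... | yes adjacent = adjacent
... | no none = ⊥-elim (alternating-pentagon-impossible (alt 0F) (alt 1F) (alt 2F) (alt 3F) (alt 4F))
  where
  alt : ∀ i → c (next i) ≡ not (c i)
  alt i = covered∧¬both⇒alternate (covered i) (λ both → none (i , both))

module _ (G : Graph) (b : Fin (nV G) → Bool) where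

  atEnds : (Bool → Bool → Bool) → Fin (nE G) → Bool
  atEnds _∙_ e = b (proj₁ (ends G e)) ∙ b (proj₂ (ends G e))

  joins⇒atEnds≡ : ∀ {_∙_ e x y} → (∀ p q → p ∙ q ≡ q ∙ p) → Joins G e x y → atEnds _∙_ e ≡ b x ∙ b y
  joins⇒atEnds≡ _ (inj₁ eq) rewrite eq = refl
  joins⇒atEnds≡ {x = x} {y} comm (inj₂ eq) rewrite eq = comm (b y) (b x)

  pentagon-has-doubly-marked-side : (P : Pentagon G) → (∀ e → T (atEnds _∨_ e)) →
    Any (T ∘ atEnds _∧_) (sides P)
  pentagon-has-doubly-marked-side P cover =
    tabulate⁺ {f = side} i (subst T (sym (joins⇒atEnds≡ ∧-comm (joins i))) adjacent-marked)
    where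
    open Pentagon P
    corners-cover : ∀ i → T (b (corner i) ∨ b (corner (next i)))
    corners-cover i = subst T (joins⇒atEnds≡ ∨-comm (joins i)) (cover (side i))
    i : Fin 5
    i = proj₁ (pentagon-cover-has-adjacent-pair (b ∘ corner) corners-cover)
    adjacent-marked : T (b (corner i) ∧ b (corner (next i)))
    adjacent-marked = proj₂ (pentagon-cover-has-adjacent-pair (b ∘ corner) corners-cover)

module _ (G : Graph) (f : Fin (nV G) → List ℕ) where

  singleton : Fin (nV G) → Bool
  singleton v = card (f v) ≡ᵇ 1

  weak-IASI-singletons-cover : Loopless G → IsWeakIASI G f → ∀ e → T (atEnds G singleton _∨_ e)
  weak-IASI-singletons-cover loopless ((f-injective , _) , weak) e
    with weakly-summable⇒singleton (weak e) (loopless e ∘ f-injective _ _)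
  ... | inj₁ |A|≡1 = Equivalence.from T-∨ (inj₁ (≡⇒≡ᵇ _ 1 |A|≡1))
  ... | inj₂ |B|≡1 = Equivalence.from T-∨ (inj₂ (≡⇒≡ᵇ _ 1 |B|≡1))

  weak-IASI-singleton-ends⇒mono : IsWeakIASI G f → ∀ e →
    T (atEnds G singleton _∧_ e) → card (edgeLabel G f e) ≡ 1
  weak-IASI-singleton-ends⇒mono (_ , weak) e both =
    trans (weak e) (cong₂ _⊔_ (≡ᵇ⇒≡ (card (f u)) 1 (proj₁ marked)) (≡ᵇ⇒≡ (card (f v)) 1 (proj₂ marked)))
    where
    u v : Fin (nV G)
    u = proj₁ (ends G e)
    v = proj₂ (ends G e)
    marked : T (singleton u) × T (singleton v)
    marked = Equivalence.to T-∧ both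

  faces≤2·monoCount : Loopless G → (faces : List (Pentagon G)) →
    concatMap sides faces ↭ allFin (nE G) ++ allFin (nE G) →
    IsWeakIASI G f → length faces ≤ 2 * monoCount G f
  faces≤2·monoCount loopless faces double-cover weakIASI = begin
    length faces                                  ≤⟨ length≤count-concatMap both? hit faces ⟩
    count both? (concatMap sides faces)           ≡⟨ count-↭ both? double-cover ⟩
    count both? (allFin (nE G) ++ allFin (nE G))  ≡⟨ count-++ both? (allFin (nE G)) _ ⟩
    count both? (allFin (nE G)) + count both? (allFin (nE G))
                                                  ≡⟨ cong (count both? (allFin (nE G)) +_) (+-identityʳ _) ⟨
    2 * count both? (allFin (nE G))               ≤⟨ *-monoʳ-≤ 2 (count-mono both? mono? both⇒mono (allFin (nE G))) ⟩
    2 * monoCount G f                             ∎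
    where
    open ≤-Reasoning
    both? : Decidable (T ∘ atEnds G singleton _∧_)
    both? e = T? (atEnds G singleton _∧_ e)
    mono? : Decidable (λ e → card (edgeLabel G f e) ≡ 1)
    mono? e = card (edgeLabel G f e) ℕ.≟ 1
    both⇒mono : ∀ {e} → T (atEnds G singleton _∧_ e) → card (edgeLabel G f e) ≡ 1
    both⇒mono = weak-IASI-singleton-ends⇒mono weakIASI _
    hit : ∀ P → Any (T ∘ atEnds G singleton _∧_) (sides P)
    hit P = pentagon-has-doubly-marked-side G singleton P (weak-IASI-singletons-cover loopless weakIASI)

-- (corners , sides): the faces u_i u_{i+1} u_{i+2} v_{i+2} v_i (indices mod 10) and the two inner pentagons.
dodecahedron-faces : Vec (Vec (Fin 20) 5 × Vec (Fin 30) 5) 12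
dodecahedron-faces =
  ((# 0 ∷ # 1 ∷ # 2 ∷ # 12 ∷ # 10 ∷ []) , (# 0 ∷ # 1 ∷ # 12 ∷ # 20 ∷ # 10 ∷ [])) ∷
  ((# 1 ∷ # 2 ∷ # 3 ∷ # 13 ∷ # 11 ∷ []) , (# 1 ∷ # 2 ∷ # 13 ∷ # 21 ∷ # 11 ∷ [])) ∷
  ((# 2 ∷ # 3 ∷ # 4 ∷ # 14 ∷ # 12 ∷ []) , (# 2 ∷ # 3 ∷ # 14 ∷ # 22 ∷ # 12 ∷ [])) ∷
  ((# 3 ∷ # 4 ∷ # 5 ∷ # 15 ∷ # 13 ∷ []) , (# 3 ∷ # 4 ∷ # 15 ∷ # 23 ∷ # 13 ∷ [])) ∷
  ((# 4 ∷ # 5 ∷ # 6 ∷ # 16 ∷ # 14 ∷ []) , (# 4 ∷ # 5 ∷ # 16 ∷ # 24 ∷ # 14 ∷ [])) ∷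
  ((# 5 ∷ # 6 ∷ # 7 ∷ # 17 ∷ # 15 ∷ []) , (# 5 ∷ # 6 ∷ # 17 ∷ # 25 ∷ # 15 ∷ [])) ∷
  ((# 6 ∷ # 7 ∷ # 8 ∷ # 18 ∷ # 16 ∷ []) , (# 6 ∷ # 7 ∷ # 18 ∷ # 26 ∷ # 16 ∷ [])) ∷
  ((# 7 ∷ # 8 ∷ # 9 ∷ # 19 ∷ # 17 ∷ []) , (# 7 ∷ # 8 ∷ # 19 ∷ # 27 ∷ # 17 ∷ [])) ∷
  ((# 8 ∷ # 9 ∷ # 0 ∷ # 10 ∷ # 18 ∷ []) , (# 8 ∷ # 9 ∷ # 10 ∷ # 28 ∷ # 18 ∷ [])) ∷
  ((# 9 ∷ # 0 ∷ # 1 ∷ # 11 ∷ # 19 ∷ []) , (# 9 ∷ # 0 ∷ # 11 ∷ # 29 ∷ # 19 ∷ [])) ∷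
  ((# 10 ∷ # 12 ∷ # 14 ∷ # 16 ∷ # 18 ∷ []) , (# 20 ∷ # 22 ∷ # 24 ∷ # 26 ∷ # 28 ∷ [])) ∷
  ((# 11 ∷ # 13 ∷ # 15 ∷ # 17 ∷ # 19 ∷ []) , (# 21 ∷ # 23 ∷ # 25 ∷ # 27 ∷ # 29 ∷ [])) ∷
  []

joins? : ∀ G e x y → Dec (Joins G e x y)
joins? G e x y = ends G e ≟ᵉ (x , y) ⊎-dec ends G e ≟ᵉ (y , x)
  where
  _≟ᵉ_ : DecidableEquality (Fin (nV G) × Fin (nV G))
  _≟ᵉ_ = ≡-dec Fin._≟_ Fin._≟_

dodecahedron-faces-joins : ∀ k i →
  let (corners , sides) = lookup dodecahedron-faces k in
  Joins dodecahedron (lookup sides i) (lookup corners i) (lookup corners (next i))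
dodecahedron-faces-joins = toWitness {a? = all? λ k → all? λ i →
  let (corners , sides) = lookup dodecahedron-faces k in
  joins? dodecahedron (lookup sides i) (lookup corners i) (lookup corners (next i))} _

dodecahedron-pentagon : Fin 12 → Pentagon dodecahedron
dodecahedron-pentagon k = record
  { corner = lookup (proj₁ (lookup dodecahedron-faces k))
  ; side   = lookup (proj₂ (lookup dodecahedron-faces k))
  ; joins  = dodecahedron-faces-joins k
  }

dodecahedron-pentagons : List (Pentagon dodecahedron)
dodecahedron-pentagons = tabulate dodecahedron-pentagon

dodecahedron-edges-on-two-pentagons : concatMap sides dodecahedron-pentagons ↭ allFin 30 ++ allFin 30
dodecahedron-edges-on-two-pentagons =
  toWitness {a? = _↭?_ Fin._≟_ (concatMap sides dodecahedron-pentagons) (allFin 30 ++ allFin 30)} _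

dodecahedron-loopless : Loopless dodecahedron
dodecahedron-loopless =
  toWitness {a? = all? λ e → ¬? (proj₁ (ends dodecahedron e) Fin.≟ proj₂ (ends dodecahedron e))} _

dodecahedron-mono-lower-bound : ∀ f → IsWeakIASI dodecahedron f → 6 ≤ monoCount dodecahedron f
dodecahedron-mono-lower-bound f weakIASI =
  *-cancelˡ-≤ 2 (faces≤2·monoCount dodecahedron f dodecahedron-loopless dodecahedron-pentagons
                   dodecahedron-edges-on-two-pentagons weakIASI)

Incomparable : ∀ {n} → (Fin n → List ℕ) → Set
Incomparable g = ∀ u v → u ≡ v ⊎ ¬ (g u ⊆ g v)

incomparable? : ∀ {n} (g : Fin n → List ℕ) → Dec (Incomparable g)
incomparable? g = all? λ u → all? λ v → (u Fin.≟ v) ⊎-dec ¬? (g u ⊆? g v)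

incomparable⇒injective : ∀ {n} {g : Fin n → List ℕ} → Incomparable g →
  ∀ u v → SetEq (g u) (g v) → u ≡ v
incomparable⇒injective incomparable u v gu≈gv with incomparable u v
... | inj₁ u≡v   = u≡v
... | inj₂ gu⊈gv = ⊥-elim (gu⊈gv (Equivalence.to (gu≈gv _)))

dodecahedron-labelling : Fin 20 → List ℕ
dodecahedron-labelling = lookup
  ((2 ∷ 27 ∷ []) ∷ (5 ∷ []) ∷ (55 ∷ 56 ∷ []) ∷ (3 ∷ []) ∷ (39 ∷ []) ∷
   (42 ∷ 45 ∷ []) ∷ (38 ∷ []) ∷ (14 ∷ 37 ∷ []) ∷ (47 ∷ []) ∷ (1 ∷ []) ∷
   (51 ∷ []) ∷ (28 ∷ []) ∷ (54 ∷ []) ∷ (44 ∷ 58 ∷ []) ∷ (19 ∷ 22 ∷ []) ∷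
   (15 ∷ []) ∷ (31 ∷ []) ∷ (50 ∷ []) ∷ (7 ∷ 21 ∷ []) ∷ (49 ∷ 57 ∷ []) ∷ [])

dodecahedron-labelling-weak-IASI : IsWeakIASI dodecahedron dodecahedron-labelling
dodecahedron-labelling-weak-IASI =
  ( incomparable⇒injective (toWitness {a? = incomparable? g} _)
  , incomparable⇒injective (toWitness {a? = incomparable? (edgeLabel dodecahedron g)} _) )
  , toWitness {a? = all? λ e → card (edgeLabel dodecahedron g e) ℕ.≟
                                max (card (g (proj₁ (ends dodecahedron e)))) (card (g (proj₂ (ends dodecahedron e))))} _
  where
  g : Fin 20 → List ℕ
  g = dodecahedron-labelling

mainTheorem15 : SparingNumberIs dodecahedron 6
mainTheorem15 =
  (dodecahedron-labelling , dodecahedron-labelling-weak-IASI , refl) , dodecahedron-mono-lower-bound
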